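{- Let $G=(V,E)$ be a connected graph with at least two vertices and let $S\subseteq V$. The following are equivalent: (a) there exists a spanning tree $T$ of $G$ such that $S$ is a vertex cover of $T$; (b) for every nonempty proper subset $C\subsetneq V$, there exist vertices $u,v$ with $uv\in E$, $u\in C$, $v\in V\setminus C$, and $u\in S$ or $v\in S$.
   Context: A vertex cover of a tree $T$ is a set of vertices containing at least one endpoint of every edge of $T$. Graphs are finite and simple. -}

module Defs where

open import Data.Nat using (ℕ; _≤_)
open import Data.Bool using (Bool; true; false)
open import Data.Fin using (Fin)
open import Data.Fin.Subset using (Subset; _∈_; _∉_)
open import Data.List using (List; []; _∷_; length; _∷ʳ_)
open import Data.List.Relation.Unary.Unique.Propositional using (Unique)
open import Data.List.Relation.Unary.Linked using (Linked)
open import Data.Product using (Σ; _×_; ∃; ∃-syntax)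
open import Data.Sum using (_⊎_)
open import Relation.Binary.PropositionalEquality using (_≡_)
open import Relation.Nullary using (¬_)
open import Data.Empty using (⊥)

record Graph (n : ℕ) : Set where
  field
    adj    : Fin n → Fin n → Bool
    sym    : ∀ u v → adj u v ≡ adj v u
    irrefl : ∀ u → adj u u ≡ false

open Graph public

Edge : ∀ {n} → Graph n → Fin n → Fin n → Set
Edge G u v = adj G u v ≡ true

data Walk {n : ℕ} (G : Graph n) : Fin n → Fin n → Set where
  here : ∀ {u} → Walk G u u
  step : ∀ {u v w} → Edge G u v → Walk G v w → Walk G u w

Connected : ∀ {n} → Graph n → Set
Connected G = ∀ u v → Walk G u v

IsCycle : ∀ {n} → Graph n → List (Fin n) → Set
IsCycle G [] = ⊥
IsCycle G (v ∷ vs) = Unique (v ∷ vs) × 2 ≤ length vs × Linked (Edge G) ((v ∷ vs) ∷ʳ v)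

Acyclic : ∀ {n} → Graph n → Set
Acyclic G = ∀ cs → ¬ IsCycle G cs

IsTree : ∀ {n} → Graph n → Set
IsTree G = Connected G × Acyclic G

Subgraph : ∀ {n} → Graph n → Graph n → Set
Subgraph H G = ∀ u v → Edge H u v → Edge G u v

SpanningTree : ∀ {n} → Graph n → Graph n → Set
SpanningTree T G = Subgraph T G × IsTree T

VertexCover : ∀ {n} → Graph n → Subset n → Set
VertexCover G S = ∀ u v → Edge G u v → u ∈ S ⊎ v ∈ S

CutCondition : ∀ {n} → Graph n → Subset n → Set
CutCondition {n} G S =
  (C : Subset n) → (∃[ x ] x ∈ C) → (∃[ y ] y ∉ C) →
  ∃[ u ] ∃[ v ] (Edge G u v × u ∈ C × v ∉ C × (u ∈ S ⊎ v ∈ S))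

{-# OPTIONS --safe #-}
-- (a) ⇒ (b): a walk in T from a vertex of C to one outside C leaves C along an edge of T,
-- and S covers that edge.
-- (b) ⇒ (a): the edges of G with an endpoint in S satisfy the cut condition, so starting
-- from a root one can keep attaching an outside vertex v to the current tree through such an
-- edge uv, recording u as the parent of v and giving v a rank above that of u. The graph of
-- these parent links is connected (follow parents to the root) and acyclic: going around a
-- cycle one can never step to a child and then to a parent, since the middle vertex would
-- have both its cycle neighbours as parent; so all steps go the same way and the ranks would
-- be strictly monotone all the way around.
module Submission where

open import Defs
open import Data.Nat using (ℕ; suc; _≤_; _<_; s≤s)
open import Data.Nat.Properties using (<-trans; <-irrefl; <-asym; ≤-trans; n<1+n)
open import Data.Fin using (Fin; _≟_) renaming (zero to fzero)
open import Data.Fin.Subset using (Subset; _∈_; _∉_; _∪_; _⊂_; _⊃_; ⁅_⁆; ∁; ⊤)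
open import Data.Fin.Subset.Induction using (Acc; acc; ⊃-wellFounded)
open import Data.Fin.Subset.Properties
  using (x∈p∪q⁻; x∈p∪q⁺; p⊆p∪q; x∈⁅x⁆; x∈⁅y⁆⇒x≡y; ∈⊤; ⊆⊤; ⊆-antisym;
         nonempty?; x∈∁p⇒x∉p; x∉∁p⇒x∈p; _∈?_)
open import Data.Vec.Functional using (updateAt)
open import Data.Vec.Functional.Properties using (updateAt-updates; updateAt-minimal)
open import Data.List using (List; []; _∷_; _∷ʳ_; length)
import Data.List.Relation.Unary.All as All
open import Data.List.Relation.Unary.All using (All; _∷_)
open import Data.List.Relation.Unary.AllPairs using (_∷_)
open import Data.List.Relation.Unary.Any using (Any; here; there)
open import Data.List.Relation.Unary.Unique.Propositional using (Unique)
open import Data.List.Relation.Unary.Unique.Propositional.Properties using (Unique[x∷xs]⇒x∉xs)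
import Data.List.Relation.Unary.Linked as Linked
open import Data.List.Relation.Unary.Linked using (Linked; [-]; _∷_)
open import Data.Product using (_×_; _,_; proj₁; proj₂; ∃-syntax)
import Data.Product as Product
open import Data.Sum using (_⊎_; inj₁; inj₂; [_,_])
import Data.Sum as Sum
open import Data.Bool using (true)
open import Data.Unit using (tt)
import Data.Unit as Unit
open import Data.Empty using (⊥; ⊥-elim)
open import Function using (_∘_; const)
open import Function.Bundles using (_⇔_; mk⇔)
open import Relation.Binary.PropositionalEquality using (_≡_; _≢_; refl; trans; cong; subst; ≢-sym)
open import Relation.Nullary using (¬_; Dec; yes; no; does; contradiction)
open import Relation.Nullary.Decidable using (dec-true; dec-false; does-⇔; _⊎-dec_; _×-dec_; ¬?)

module _ {n} {G : Graph n} where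

  _++ʷ_ : ∀ {x y z} → Walk G x y → Walk G y z → Walk G x z
  here      ++ʷ w = w
  step e w₁ ++ʷ w = step e (w₁ ++ʷ w)

  reverseʷ : ∀ {x y} → Walk G x y → Walk G y x
  reverseʷ here               = here
  reverseʷ (step {u} {v} e w) = reverseʷ w ++ʷ step (trans (sym G v u) e) here

  connected-via : ∀ (c : Fin n) → (∀ u → Walk G u c) → Connected G
  connected-via c walk u v = walk u ++ʷ reverseʷ (walk v)

  walk-leaves : ∀ (C : Subset n) {x y} → Walk G x y → x ∈ C → y ∉ C →
                ∃[ u ] ∃[ v ] (Edge G u v × u ∈ C × v ∉ C)
  walk-leaves C here                 x∈C x∉C = ⊥-elim (x∉C x∈C)
  walk-leaves C (step {v = v} e w) u∈C y∉C with v ∈? C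
  ... | yes v∈C = walk-leaves C w v∈C y∉C
  ... | no  v∉C = _ , _ , e , u∈C , v∉C

module _ {V : Set} where

  NonBacktracking : List V → Set
  NonBacktracking (a ∷ b ∷ c ∷ rest) = a ≢ c × NonBacktracking (b ∷ c ∷ rest)
  NonBacktracking _                  = Unit.⊤

  nonBacktracking-∷ʳ : ∀ {xs z} → Unique xs → All (_≢ z) xs → NonBacktracking (xs ∷ʳ z)
  nonBacktracking-∷ʳ {[]}             _                        _         = tt
  nonBacktracking-∷ʳ {_ ∷ []}         _                        _         = tt
  nonBacktracking-∷ʳ {_ ∷ _ ∷ []}     _                        (a≢z ∷ _) = a≢z , tt
  nonBacktracking-∷ʳ {_ ∷ _ ∷ _ ∷ _} ((_ ∷ a≢c ∷ _) ∷ unique) (_ ∷ ≢z)  =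
    a≢c , nonBacktracking-∷ʳ unique ≢z

  cycle-nonBacktracking : ∀ {v v₁ v₂ vs} → Unique (v ∷ v₁ ∷ v₂ ∷ vs) →
                          NonBacktracking (v ∷ v₁ ∷ v₂ ∷ vs ∷ʳ v)
  cycle-nonBacktracking (v≢@(_ ∷ v≢v₂ ∷ _) ∷ unique) =
    v≢v₂ , nonBacktracking-∷ʳ unique (All.map ≢-sym v≢)

module RankedParent {V : Set} (parent : V → V) (rank : V → ℕ) where

  infix 4 _↑_ _—_

  _↑_ : V → V → Set
  a ↑ b = parent a ≡ b × rank b < rank a

  _—_ : V → V → Set
  a — b = a ↑ b ⊎ b ↑ a

  ↑-functional : ∀ {a b c} → a ↑ b → a ↑ c → b ≡ c
  ↑-functional (refl , _) (refl , _) = refl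

  descend : ∀ a b rest z → b ↑ a → NonBacktracking (a ∷ b ∷ rest ∷ʳ z) →
            Linked _—_ (b ∷ rest ∷ʳ z) → rank a < rank z × Any (parent z ≡_) (b ∷ rest)
  descend a b []         z b↑a (a≢z , _) (inj₁ b↑z ∷ [-]) = ⊥-elim (a≢z (↑-functional b↑a b↑z))
  descend a b []         z b↑a _         (inj₂ z↑b ∷ [-]) = <-trans (proj₂ b↑a) (proj₂ z↑b) , here (proj₁ z↑b)
  descend a b (c ∷ rest) z b↑a (a≢c , _) (inj₁ b↑c ∷ _)   = ⊥-elim (a≢c (↑-functional b↑a b↑c))
  descend a b (c ∷ rest) z b↑a (_ , nb)  (inj₂ c↑b ∷ l)   =
    Product.map (<-trans (proj₂ b↑a)) there (descend b c rest z c↑b nb l)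

  climb : ∀ a b rest z → a ↑ b → NonBacktracking (a ∷ b ∷ rest ∷ʳ z) →
          Linked _—_ (b ∷ rest ∷ʳ z) → rank z < rank a ⊎ Any (parent z ≡_) (b ∷ rest)
  climb a b []         z a↑b _        (inj₁ b↑z ∷ [-]) = inj₁ (<-trans (proj₂ b↑z) (proj₂ a↑b))
  climb a b []         z a↑b _        (inj₂ z↑b ∷ [-]) = inj₂ (here (proj₁ z↑b))
  climb a b (c ∷ rest) z a↑b (_ , nb) (inj₁ b↑c ∷ l)   =
    Sum.map (λ rz<rb → <-trans rz<rb (proj₂ a↑b)) there (climb b c rest z b↑c nb l)
  climb a b (c ∷ rest) z a↑b (_ , nb) (inj₂ c↑b ∷ l)   = inj₂ (there (proj₂ (descend b c rest z c↑b nb l)))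

  no-cycle : ∀ v vs → Unique (v ∷ vs) → 2 ≤ length vs → ¬ Linked _—_ (v ∷ vs ∷ʳ v)
  no-cycle v (_ ∷ [])         _                     (s≤s ())
  no-cycle v (v₁ ∷ v₂ ∷ rest) unique@(_ ∷ unique₁) _ (v—v₁ ∷ v₁—v₂ ∷ l) = cases v—v₁ v₁—v₂
    where
      nb : NonBacktracking (v ∷ v₁ ∷ v₂ ∷ rest ∷ʳ v)
      nb = cycle-nonBacktracking unique

      parent-v∉ : parent v ≡ v₁ → ¬ Any (parent v ≡_) (v₂ ∷ rest)
      parent-v∉ refl = Unique[x∷xs]⇒x∉xs unique₁

      cases : v — v₁ → v₁ — v₂ → ⊥
      cases (inj₂ v₁↑v)             _            =
        <-irrefl refl (proj₁ (descend v v₁ (v₂ ∷ rest) v v₁↑v nb (v₁—v₂ ∷ l)))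
      cases (inj₁ (pv≡v₁ , rv₁<rv)) (inj₂ v₂↑v₁) =
        parent-v∉ pv≡v₁ (proj₂ (descend v₁ v₂ rest v v₂↑v₁ (proj₂ nb) l))
      cases (inj₁ (pv≡v₁ , rv₁<rv)) (inj₁ v₁↑v₂) =
        [ <-asym rv₁<rv , parent-v∉ pv≡v₁ ] (climb v₁ v₂ rest v v₁↑v₂ (proj₂ nb) l)

does≡true⇒ : ∀ {A : Set} (a? : Dec A) → does a? ≡ true → A
does≡true⇒ (yes a) _  = a
does≡true⇒ (no _)  ()

module ParentGraph {n} (root : Fin n) (parent : Fin n → Fin n) (rank : Fin n → ℕ)
  (rank-parent : ∀ {u} → u ≢ root → rank (parent u) < rank u) where

  open RankedParent parent rank using (_↑_; no-cycle)

  infix 4 _⇝_ _⇝?_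

  _⇝_ : Fin n → Fin n → Set
  u ⇝ v = u ≢ root × parent u ≡ v

  _⇝?_ : ∀ u v → Dec (u ⇝ v)
  u ⇝? v = ¬? (u ≟ root) ×-dec parent u ≟ v

  ⇝-irrefl : ∀ {u} → ¬ u ⇝ u
  ⇝-irrefl (u≢root , pu≡u) = <-irrefl (cong rank pu≡u) (rank-parent u≢root)

  ⇝⇒↑ : ∀ {u v} → u ⇝ v → u ↑ v
  ⇝⇒↑ (u≢root , refl) = refl , rank-parent u≢root

  Link : Fin n → Fin n → Set
  Link u v = u ⇝ v ⊎ v ⇝ u

  link? : ∀ u v → Dec (Link u v)
  link? u v = u ⇝? v ⊎-dec v ⇝? u

  parentGraph : Graph n
  parentGraph = record
    { adj    = λ u v → does (link? u v)
    ; sym    = λ u v → does-⇔ (mk⇔ Sum.swap Sum.swap) (link? u v) (link? v u)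
    ; irrefl = λ u → dec-false (link? u u) [ ⇝-irrefl , ⇝-irrefl ]
    }

  edge⇒link : ∀ {u v} → Edge parentGraph u v → Link u v
  edge⇒link {u} {v} = does≡true⇒ (link? u v)

  link⇒edge : ∀ {u v} → Link u v → Edge parentGraph u v
  link⇒edge {u} {v} = dec-true (link? u v)

  walk-to-root : ∀ k u → rank u < k → Walk parentGraph u root
  walk-to-root (suc k) u (s≤s ru≤k) with u ≟ root
  ... | yes refl    = here
  ... | no  u≢root  = step (link⇒edge (inj₁ (u≢root , refl)))
                           (walk-to-root k (parent u) (≤-trans (rank-parent u≢root) ru≤k))

  parentGraph-acyclic : Acyclic parentGraph
  parentGraph-acyclic (v ∷ vs) (unique , 2≤∣vs∣ , cycle) =
    no-cycle v vs unique 2≤∣vs∣ (Linked.map (Sum.map ⇝⇒↑ ⇝⇒↑ ∘ edge⇒link) cycle)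

  parentGraph-isTree : IsTree parentGraph
  parentGraph-isTree = connected-via root (λ u → walk-to-root _ u (n<1+n (rank u))) , parentGraph-acyclic

p⊂p∪⁅x⁆ : ∀ {n} {p : Subset n} {x} → x ∉ p → p ⊂ p ∪ ⁅ x ⁆
p⊂p∪⁅x⁆ {x = x} x∉p = p⊆p∪q ⁅ x ⁆ , x , x∈p∪q⁺ (inj₂ (x∈⁅x⁆ x)) , x∉p

record ParentTree {n} (H : Fin n → Fin n → Set) (root : Fin n) (R : Subset n) : Set where
  field
    parent   : Fin n → Fin n
    rank     : Fin n → ℕ
    root∈R   : root ∈ R
    parent∈R : ∀ {u} → u ∈ R → u ≢ root → parent u ∈ R
    rank-<   : ∀ {u} → u ∈ R → u ≢ root → rank (parent u) < rank u
    parent-H : ∀ {u} → u ∈ R → u ≢ root → H u (parent u)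

module _ {n} (H : Fin n → Fin n → Set) (root : Fin n) where

  singletonTree : ParentTree H root ⁅ root ⁆
  singletonTree = record
    { parent   = λ u → u
    ; rank     = const 0
    ; root∈R   = x∈⁅x⁆ root
    ; parent∈R = only-root
    ; rank-<   = only-root
    ; parent-H = only-root
    }
    where
      only-root : ∀ {A : Set} {u} → u ∈ ⁅ root ⁆ → u ≢ root → A
      only-root u∈ u≢root = contradiction (x∈⁅y⁆⇒x≡y root u∈) u≢root

  extendTree : ∀ {R u v} → ParentTree H root R → u ∈ R → v ∉ R → H v u →
               ParentTree H root (R ∪ ⁅ v ⁆)
  extendTree {R} {u} {v} t u∈R v∉R Hvu = record
    { parent   = parent′
    ; rank     = rank′
    ; root∈R   = p⊆p∪q ⁅ v ⁆ root∈R
    ; parent∈R = parent∈R′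
    ; rank-<   = rank-<′
    ; parent-H = parent-H′
    }
    where
      open ParentTree t

      parent′ : Fin n → Fin n
      parent′ = updateAt parent v (const u)

      rank′ : Fin n → ℕ
      rank′ = updateAt rank v (const (suc (rank u)))

      old-or-new : ∀ {x} → x ∈ R ∪ ⁅ v ⁆ → x ∈ R ⊎ x ≡ v
      old-or-new x∈ = Sum.map₂ (x∈⁅y⁆⇒x≡y v) (x∈p∪q⁻ R ⁅ v ⁆ x∈)

      ∈R⇒≢v : ∀ {x} → x ∈ R → x ≢ v
      ∈R⇒≢v x∈R refl = v∉R x∈R

      parent′-old : ∀ {x} → x ∈ R → parent′ x ≡ parent x
      parent′-old x∈R = updateAt-minimal _ v parent (∈R⇒≢v x∈R)

      rank′-old : ∀ {x} → x ∈ R → rank′ x ≡ rank x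
      rank′-old x∈R = updateAt-minimal _ v rank (∈R⇒≢v x∈R)

      parent∈R′ : ∀ {x} → x ∈ R ∪ ⁅ v ⁆ → x ≢ root → parent′ x ∈ R ∪ ⁅ v ⁆
      parent∈R′ x∈ x≢root with old-or-new x∈
      ... | inj₁ x∈R rewrite parent′-old x∈R       = p⊆p∪q ⁅ v ⁆ (parent∈R x∈R x≢root)
      ... | inj₂ refl rewrite updateAt-updates v {const u} parent = p⊆p∪q ⁅ v ⁆ u∈R

      rank-<′ : ∀ {x} → x ∈ R ∪ ⁅ v ⁆ → x ≢ root → rank′ (parent′ x) < rank′ x
      rank-<′ x∈ x≢root with old-or-new x∈
      ... | inj₁ x∈R
        rewrite parent′-old x∈R | rank′-old x∈R | rank′-old (parent∈R x∈R x≢root) = rank-< x∈R x≢root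
      ... | inj₂ refl
        rewrite updateAt-updates v {const u} parent | updateAt-updates v {const (suc (rank u))} rank
              | rank′-old u∈R = n<1+n (rank u)

      parent-H′ : ∀ {x} → x ∈ R ∪ ⁅ v ⁆ → x ≢ root → H x (parent′ x)
      parent-H′ x∈ x≢root with old-or-new x∈
      ... | inj₁ x∈R rewrite parent′-old x∈R       = parent-H x∈R x≢root
      ... | inj₂ refl rewrite updateAt-updates v {const u} parent = Hvu

  module _ (expand : ∀ (C : Subset n) → ∃[ x ] x ∈ C → ∃[ y ] y ∉ C →
                     ∃[ u ] ∃[ v ] (u ∈ C × v ∉ C × H v u)) where

    growTree : ∀ {R} → Acc _⊃_ R → ParentTree H root R → ParentTree H root ⊤
    growTree {R} (acc more) t with nonempty? (∁ R)
    ... | no ∁R-empty = subst (ParentTree H root) R≡⊤ t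
      where R≡⊤ : R ≡ ⊤
            R≡⊤ = ⊆-antisym ⊆⊤ (λ _ → x∉∁p⇒x∈p (λ x∈∁R → ∁R-empty (_ , x∈∁R)))
    ... | yes (y , y∈∁R) with expand R (root , ParentTree.root∈R t) (y , x∈∁p⇒x∉p y∈∁R)
    ...   | u , v , u∈R , v∉R , Hvu =
      growTree (more (p⊂p∪⁅x⁆ v∉R)) (extendTree t u∈R v∉R Hvu)

    spanningParentTree : ParentTree H root ⊤
    spanningParentTree = growTree (⊃-wellFounded ⁅ root ⁆) singletonTree

CoveredSpanningTree : ∀ {n} → Graph n → Subset n → Set
CoveredSpanningTree G S = ∃[ T ] (SpanningTree T G × VertexCover T S)

coveredSpanningTree⇒cutCondition : ∀ {n} (G : Graph n) (S : Subset n) →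
                                    CoveredSpanningTree G S → CutCondition G S
coveredSpanningTree⇒cutCondition G S (T , (T⊆G , T-connected , _) , cover) C (x , x∈C) (y , y∉C)
  with u , v , e , u∈C , v∉C ← walk-leaves C (T-connected x y) x∈C y∉C
  = u , v , T⊆G u v e , u∈C , v∉C , cover u v e

module _ {n} (G : Graph n) (S : Subset n) where

  CoveredEdge : Fin n → Fin n → Set
  CoveredEdge u v = Edge G u v × (u ∈ S ⊎ v ∈ S)

  cutCondition⇒coveredSpanningTree : Fin n → CutCondition G S → CoveredSpanningTree G S
  cutCondition⇒coveredSpanningTree root cut =
    parentGraph , (parentGraph⊆G , parentGraph-isTree) , S-covers-parentGraph
    where
      expand : ∀ (C : Subset n) → ∃[ x ] x ∈ C → ∃[ y ] y ∉ C →
               ∃[ u ] ∃[ v ] (u ∈ C × v ∉ C × CoveredEdge v u)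
      expand C x∈C y∉C with u , v , e , u∈C , v∉C , cov ← cut C x∈C y∉C =
        u , v , u∈C , v∉C , trans (sym G v u) e , Sum.swap cov

      open ParentTree (spanningParentTree CoveredEdge root expand)

      covered : ∀ {u} → u ≢ root → CoveredEdge u (parent u)
      covered = parent-H ∈⊤

      open ParentGraph root parent rank (rank-< ∈⊤)

      parentGraph⊆G : Subgraph parentGraph G
      parentGraph⊆G u v e with edge⇒link {u} {v} e
      ... | inj₁ (u≢root , refl) = proj₁ (covered u≢root)
      ... | inj₂ (v≢root , refl) = trans (sym G u v) (proj₁ (covered v≢root))

      S-covers-parentGraph : VertexCover parentGraph S
      S-covers-parentGraph u v e with edge⇒link {u} {v} e
      ... | inj₁ (u≢root , refl) = proj₂ (covered u≢root)
      ... | inj₂ (v≢root , refl) = Sum.swap (proj₂ (covered v≢root))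

lemma6 : (n : ℕ) → 2 ≤ n → (G : Graph n) → Connected G → (S : Subset n) →
    (∃[ T ] (SpanningTree T G × VertexCover T S)) ⇔ CutCondition G S
lemma6 (suc n) _ G _ S =
  mk⇔ (coveredSpanningTree⇒cutCondition G S) (cutCondition⇒coveredSpanningTree G S fzero)
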